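{- Let $S$ be a closed $\Sigma$-formula and $A(x)$ an arbitrary formula. Then the formula \[ \Big(\big(\forall x\,(A(x)\vee(A(x)\to S))\big)\to S\Big)\to S \] is provable (with an unmarked sequent $\vdash$) in the system $\mathrm{MQC}^+_S$.
   Context: $\mathrm{MQC}^+_S$, parameterized by a closed $\Sigma$-formula $S$, is the following natural deduction system. Judgements are sequents $\Gamma\vdash A$ (unmarked) or $\Gamma\vdash_S A$ (marked). All usual rules of minimal intuitionistic predicate logic (axiom, introduction and elimination for $\wedge,\vee,\to,\forall,\exists$; no ex falso rule) are allowed in both forms, with the same marker (unmarked or marked) in all premises and conclusion. Two additional rules: reset: from $\Gamma\vdash_S S$ infer $\Gamma\vdash S$ (and also from $\Gamma\vdash_S S$ infer $\Gamma\vdash_S S$); shift: from $\Gamma, A\to S\vdash_S S$ infer $\Gamma\vdash_S A$, for any formula $A$. A formula is provable if it is derivable as $\vdash$ with empty context. A $\Sigma$-formula is one built only from existential quantifiers (over natural numbers), disjunction, conjunction and equality atoms; in pure predicate logic these are the formulas containing no $\forall$ and no $\to$. -}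

module Defs where

open import Data.Nat using (ℕ; zero; suc)
open import Data.Fin using (Fin; zero; suc)
open import Data.Vec using (Vec; []; _∷_)
open import Data.List using (List; []; _∷_; map)
open import Data.List.Membership.Propositional using (_∈_)
open import Data.Empty using (⊥)
open import Data.Unit using (⊤)
open import Data.Product using (_×_)

-- Equality atoms are modelled as atoms of a binary
-- predicate symbol (no equality rules are part of MQC⁺_S).
record Signature : Set₁ where
  field
    FunSym    : Set
    funArity  : FunSym → ℕ
    PredSym   : Set
    predArity : PredSym → ℕ

module Syntax (Sig : Signature) where
  open Signature Sig

  data Term (n : ℕ) : Set where
    var : Fin n → Term n
    fun : (f : FunSym) → Vec (Term n) (funArity f) → Term n

  -- Formulas of minimal predicate logic (no ⊥ constructor; ⊥, if wanted,
  -- is a 0-ary predicate symbol without special rules).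
  data Formula (n : ℕ) : Set where
    atom : (p : PredSym) → Vec (Term n) (predArity p) → Formula n
    _∧'_ : Formula n → Formula n → Formula n
    _∨'_ : Formula n → Formula n → Formula n
    _⇒_  : Formula n → Formula n → Formula n
    ∀'   : Formula (suc n) → Formula n
    ∃'   : Formula (suc n) → Formula n

  infixr 6 _∧'_
  infixr 5 _∨'_
  infixr 4 _⇒_

  ext : ∀ {m n} → (Fin m → Fin n) → Fin (suc m) → Fin (suc n)
  ext ρ zero    = zero
  ext ρ (suc i) = suc (ρ i)

  mutual
    renT : ∀ {m n} → (Fin m → Fin n) → Term m → Term n
    renT ρ (var i)    = var (ρ i)
    renT ρ (fun f ts) = fun f (renTs ρ ts)

    renTs : ∀ {m n k} → (Fin m → Fin n) → Vec (Term m) k → Vec (Term n) k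
    renTs ρ []       = []
    renTs ρ (t ∷ ts) = renT ρ t ∷ renTs ρ ts

  ren : ∀ {m n} → (Fin m → Fin n) → Formula m → Formula n
  ren ρ (atom p ts) = atom p (renTs ρ ts)
  ren ρ (A ∧' B)    = ren ρ A ∧' ren ρ B
  ren ρ (A ∨' B)    = ren ρ A ∨' ren ρ B
  ren ρ (A ⇒ B)     = ren ρ A ⇒ ren ρ B
  ren ρ (∀' A)      = ∀' (ren (ext ρ) A)
  ren ρ (∃' A)      = ∃' (ren (ext ρ) A)

  wk : ∀ {n} → Formula n → Formula (suc n)
  wk = ren suc

  exts : ∀ {m n} → (Fin m → Term n) → Fin (suc m) → Term (suc n)
  exts σ zero    = var zero
  exts σ (suc i) = renT suc (σ i)

  mutual
    subT : ∀ {m n} → (Fin m → Term n) → Term m → Term n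
    subT σ (var i)    = σ i
    subT σ (fun f ts) = fun f (subTs σ ts)

    subTs : ∀ {m n k} → (Fin m → Term n) → Vec (Term m) k → Vec (Term n) k
    subTs σ []       = []
    subTs σ (t ∷ ts) = subT σ t ∷ subTs σ ts

  sub : ∀ {m n} → (Fin m → Term n) → Formula m → Formula n
  sub σ (atom p ts) = atom p (subTs σ ts)
  sub σ (A ∧' B)    = sub σ A ∧' sub σ B
  sub σ (A ∨' B)    = sub σ A ∨' sub σ B
  sub σ (A ⇒ B)     = sub σ A ⇒ sub σ B
  sub σ (∀' A)      = ∀' (sub (exts σ) A)
  sub σ (∃' A)      = ∃' (sub (exts σ) A)

  _[_] : ∀ {n} → Formula (suc n) → Term n → Formula n
  A [ t ] = sub σ A
    where
      σ : _ → _
      σ zero    = t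
      σ (suc i) = var i

  close : ∀ {n} → Formula 0 → Formula n
  close = ren (λ ())

  IsΣ : ∀ {n} → Formula n → Set
  IsΣ (atom p ts) = ⊤
  IsΣ (A ∧' B)    = IsΣ A × IsΣ B
  IsΣ (A ∨' B)    = IsΣ A × IsΣ B
  IsΣ (A ⇒ B)     = ⊥
  IsΣ (∀' A)      = ⊥
  IsΣ (∃' A)      = IsΣ A

  Ctx : ℕ → Set
  Ctx n = List (Formula n)

  data Mark : Set where
    unmarked marked : Mark

  -- The system MQC⁺_S.  Γ ⊢[ unmarked ] A is Γ ⊢ A, Γ ⊢[ marked ] A is Γ ⊢_S A.
  -- Contexts are lists; "Γ, A" is A ∷ Γ.  Eigenvariable conditions are
  -- handled by de Bruijn weakening of the context.
  module MQC (S : Formula 0) where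
    data _⊢[_]_ {n : ℕ} : Ctx n → Mark → Formula n → Set where
      ax   : ∀ {Γ μ A} → A ∈ Γ → Γ ⊢[ μ ] A
      ∧I   : ∀ {Γ μ A B} → Γ ⊢[ μ ] A → Γ ⊢[ μ ] B → Γ ⊢[ μ ] (A ∧' B)
      ∧E₁  : ∀ {Γ μ A B} → Γ ⊢[ μ ] (A ∧' B) → Γ ⊢[ μ ] A
      ∧E₂  : ∀ {Γ μ A B} → Γ ⊢[ μ ] (A ∧' B) → Γ ⊢[ μ ] B
      ∨I₁  : ∀ {Γ μ A B} → Γ ⊢[ μ ] A → Γ ⊢[ μ ] (A ∨' B)
      ∨I₂  : ∀ {Γ μ A B} → Γ ⊢[ μ ] B → Γ ⊢[ μ ] (A ∨' B)
      ∨E   : ∀ {Γ μ A B C} → Γ ⊢[ μ ] (A ∨' B) → (A ∷ Γ) ⊢[ μ ] C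
             → (B ∷ Γ) ⊢[ μ ] C → Γ ⊢[ μ ] C
      ⇒I   : ∀ {Γ μ A B} → (A ∷ Γ) ⊢[ μ ] B → Γ ⊢[ μ ] (A ⇒ B)
      ⇒E   : ∀ {Γ μ A B} → Γ ⊢[ μ ] (A ⇒ B) → Γ ⊢[ μ ] A → Γ ⊢[ μ ] B
      ∀I   : ∀ {Γ μ} {A : Formula (suc n)}
             → _⊢[_]_ {suc n} (map wk Γ) μ A → Γ ⊢[ μ ] ∀' A
      ∀E   : ∀ {Γ μ} {A : Formula (suc n)} → Γ ⊢[ μ ] ∀' A
             → (t : Term n) → Γ ⊢[ μ ] (A [ t ])
      ∃I   : ∀ {Γ μ} {A : Formula (suc n)} (t : Term n)
             → Γ ⊢[ μ ] (A [ t ]) → Γ ⊢[ μ ] ∃' A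
      ∃E   : ∀ {Γ μ C} {A : Formula (suc n)} → Γ ⊢[ μ ] ∃' A
             → _⊢[_]_ {suc n} (A ∷ map wk Γ) μ (wk C) → Γ ⊢[ μ ] C
      reset  : ∀ {Γ} → Γ ⊢[ marked ] close S → Γ ⊢[ unmarked ] close S
      reset' : ∀ {Γ} → Γ ⊢[ marked ] close S → Γ ⊢[ marked ] close S
      shift  : ∀ {Γ A} → ((A ⇒ close S) ∷ Γ) ⊢[ marked ] close S
             → Γ ⊢[ marked ] A

    Provable : ∀ {n} → Formula n → Set
    Provable A = [] ⊢[ unmarked ] A

module Submission where

-- In the marked system the shift rule makes the law of excluded
-- middle relative to S derivable: to prove  B ∨ (B → S)  marked, shift to the
-- goal S under the extra hypothesis  (B ∨ (B → S)) → S ; feeding that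
-- hypothesis the right disjunct  B → S  (itself obtained by feeding it the
-- left disjunct B) yields S.  Generalising over the bound variable gives the
-- marked derivation of  ∀x (A ∨ (A → S)).  Finally, whenever a formula B is
-- derivable marked (from B → S), its S-double negation (B → S) → S is derivable
-- unmarked: apply the hypothesis B → S to B in marked mode and leave marked
-- mode with the reset rule, which is allowed because the goal is S.
--
-- None of these steps uses that S is a Σ-formula, so the lemmas are stated
-- for an arbitrary closed formula S.

open import Defs
open import Data.Nat using (ℕ; suc)
open import Data.List using (_∷_)
open import Data.List.Relation.Unary.Any using (here; there)
open import Relation.Binary.PropositionalEquality using (refl)

module _ (Sig : Signature) where
  open Syntax Sig

  module _ (S : Formula 0) where
    open MQC S

    markedExcludedMiddle : ∀ {n} {Γ : Ctx n} (B : Formula n) →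
      Γ ⊢[ marked ] (B ∨' (B ⇒ close S))
    markedExcludedMiddle {Γ = Γ} B = shift (⇒E (ax (here refl)) (∨I₂ rightDisjunct))
      where
        -- Under the hypothesis introduced by shift, B → S follows by
        -- applying that hypothesis to the left disjunct B.
        rightDisjunct : (((B ∨' (B ⇒ close S)) ⇒ close S) ∷ Γ) ⊢[ marked ] (B ⇒ close S)
        rightDisjunct = ⇒I (⇒E (ax (there (here refl))) (∨I₁ (ax (here refl))))

    markedUniversalExcludedMiddle : ∀ {n} {Γ : Ctx n} (A : Formula (suc n)) →
      Γ ⊢[ marked ] ∀' (A ∨' (A ⇒ close S))
    markedUniversalExcludedMiddle A = ∀I (markedExcludedMiddle A)

    markedToDoubleNegation : ∀ {n} {Γ : Ctx n} {B : Formula n} →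
      ((B ⇒ close S) ∷ Γ) ⊢[ marked ] B →
      Γ ⊢[ unmarked ] ((B ⇒ close S) ⇒ close S)
    markedToDoubleNegation d = ⇒I (reset (⇒E (ax (here refl)) d))

theorem3 : (Sig : Signature) → let open Syntax Sig in
    (S : Formula 0) → IsΣ S → (n : ℕ) → (A : Formula (suc n)) →
    MQC.Provable S
    (((∀' (A ∨' (A ⇒ close S))) ⇒ close S) ⇒ close S)
theorem3 Sig S _ n A =
  markedToDoubleNegation Sig S (markedUniversalExcludedMiddle Sig S A)
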